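{- Let $(V,/,\bullet)$ be a static valuation algebra and let $H\in V$. There exists a valuation algebra $(\{H\},/_0,\bullet_0)$ with the single valuation $H$ such that $x/H = x/_0H$ for every formula $x$.
   Context: Fix a set $\mathcal{A}$ of atoms. Formulas: $x ::= \mathrm{T} \mid a \mid \neg x \mid x \mathbin{\triangleleft\wedge} x$ ($a\in\mathcal{A}$). A valuation algebra is a nonempty set $V$ with maps $/:\mathcal{A}\times V\to\{\mathrm{T},\mathrm{F}\}$ and $\bullet:\mathcal{A}\times V\to V$, extended to formulas by: $\mathrm{T}/H=\mathrm{T}$, $\mathrm{T}\bullet H=H$; $(\neg x)/H=\neg(x/H)$, $(\neg x)\bullet H=x\bullet H$; $(x\mathbin{\triangleleft\wedge}y)/H = y/(x\bullet H)$ if $x/H=\mathrm{T}$, else $\mathrm{F}$; $(x\mathbin{\triangleleft\wedge}y)\bullet H = y\bullet(x\bullet H)$ if $x/H=\mathrm{T}$, else $x\bullet H$. ($u\bullet v\bullet H$ means $u\bullet(v\bullet H)$.) $V$ is static if for all $a,b\in\mathcal{A}$, $H\in V$: $a/(a\bullet H)=a/H$, $a\bullet a\bullet H=a\bullet H$, $a/(b\bullet a\bullet H)=a/H$, $a\bullet b\bullet a\bullet H=b\bullet a\bullet H$, and $a/(b\bullet H)=a/H$. -}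

module Defs where

open import Level using (Level; _⊔_; suc)
open import Data.Bool using (Bool; true; false; not)
open import Data.Product using (Σ; _,_)
open import Relation.Binary.PropositionalEquality using (_≡_; refl)

data Formula {a : Level} (A : Set a) : Set a where
  TT   : Formula A
  atom : A → Formula A
  ¬'_  : Formula A → Formula A
  _◁∧_ : Formula A → Formula A → Formula A

record ValuationAlgebra {a : Level} (A : Set a) (v : Level) : Set (a ⊔ suc v) where
  field
    Carrier : Set v
    nonempty : Carrier
    _/ₐ_ : A → Carrier → Bool
    _•ₐ_ : A → Carrier → Carrier

module _ {a v : Level} {A : Set a} (𝕍 : ValuationAlgebra A v) where
  open ValuationAlgebra 𝕍

  mutual
    _/_ : Formula A → Carrier → Bool
    TT / H = true
    atom p / H = p /ₐ H
    (¬' x) / H = not (x / H)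
    (x ◁∧ y) / H with x / H
    ... | true  = y / (x • H)
    ... | false = false

    _•_ : Formula A → Carrier → Carrier
    TT • H = H
    atom p • H = p •ₐ H
    (¬' x) • H = x • H
    (x ◁∧ y) • H with x / H
    ... | true  = y • (x • H)
    ... | false = x • H

  record Static : Set (a ⊔ v) where
    field
      st₁ : ∀ (p : A) (H : Carrier) → p /ₐ (p •ₐ H) ≡ p /ₐ H
      st₂ : ∀ (p : A) (H : Carrier) → p •ₐ (p •ₐ H) ≡ p •ₐ H
      st₃ : ∀ (p q : A) (H : Carrier) → p /ₐ (q •ₐ (p •ₐ H)) ≡ p /ₐ H
      st₄ : ∀ (p q : A) (H : Carrier) → p •ₐ (q •ₐ (p •ₐ H)) ≡ q •ₐ (p •ₐ H)
      st₅ : ∀ (p q : A) (H : Carrier) → p /ₐ (q •ₐ H) ≡ p /ₐ H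

Singleton : {v : Level} {V : Set v} → V → Set v
Singleton {V = V} H = Σ V (λ u → u ≡ H)

singletonAlgebra : {a v : Level} {A : Set a} {V : Set v} (H : V) →
  (A → Singleton H → Bool) → (A → Singleton H → Singleton H) → ValuationAlgebra A v
singletonAlgebra H /₀ •₀ = record
  { Carrier = Singleton H ; nonempty = (H , refl) ; _/ₐ_ = /₀ ; _•ₐ_ = •₀ }

-- In any valuation algebra with
-- this property (we call it *reply-stable*) the action of an arbitrary
-- formula also leaves atomic replies unchanged, and hence the reply to a
-- formula is its classical truth value under the atomic replies at the
-- current valuation, reading  x ◁∧ y  as ordinary conjunction.
--
-- The theorem
-- follows by applying that lemma twice: to the static algebra 𝕍 at H, and
-- to the singleton algebra on {H} whose atomic replies are those of H and
-- whose actions are trivial (that algebra is reply-stable by definition).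
module Submission where

open import Defs
open import Level using (Level; _⊔_)
open import Data.Bool using (Bool; true; false; not; _∧_)
open import Data.Product using (Σ; _,_)
open import Relation.Binary.PropositionalEquality
  using (_≡_; refl; trans; sym; cong; cong₂; module ≡-Reasoning)

⟦_⟧ : {a : Level} {A : Set a} → Formula A → (A → Bool) → Bool
⟦ TT ⟧     ρ = true
⟦ atom p ⟧ ρ = ρ p
⟦ ¬' x ⟧   ρ = not (⟦ x ⟧ ρ)
⟦ x ◁∧ y ⟧ ρ = ⟦ x ⟧ ρ ∧ ⟦ y ⟧ ρ

⟦⟧-cong : {a : Level} {A : Set a} (x : Formula A) {ρ σ : A → Bool} →
          (∀ p → ρ p ≡ σ p) → ⟦ x ⟧ ρ ≡ ⟦ x ⟧ σ
⟦⟧-cong TT       ρ≗σ = refl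
⟦⟧-cong (atom p) ρ≗σ = ρ≗σ p
⟦⟧-cong (¬' x)   ρ≗σ = cong not (⟦⟧-cong x ρ≗σ)
⟦⟧-cong (x ◁∧ y) ρ≗σ = cong₂ _∧_ (⟦⟧-cong x ρ≗σ) (⟦⟧-cong y ρ≗σ)

module _ {a v : Level} {A : Set a} (𝕍 : ValuationAlgebra A v) where
  open ValuationAlgebra 𝕍

  replies : Carrier → A → Bool
  replies G p = p /ₐ G

  ReplyStable : Set (a ⊔ v)
  ReplyStable = ∀ (p q : A) (G : Carrier) → p /ₐ (q •ₐ G) ≡ p /ₐ G

  ◁∧-reply : ∀ x y G → _/_ 𝕍 (x ◁∧ y) G ≡ (_/_ 𝕍 x G ∧ _/_ 𝕍 y (_•_ 𝕍 x G))
  ◁∧-reply x y G with _/_ 𝕍 x G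
  ... | true  = refl
  ... | false = refl

  module _ (stable : ReplyStable) where

    atom-reply-stable : ∀ p y G → p /ₐ (_•_ 𝕍 y G) ≡ p /ₐ G
    atom-reply-stable p TT       G = refl
    atom-reply-stable p (atom q) G = stable p q G
    atom-reply-stable p (¬' y)   G = atom-reply-stable p y G
    atom-reply-stable p (x ◁∧ y) G with _/_ 𝕍 x G
    ... | true  = trans (atom-reply-stable p y (_•_ 𝕍 x G)) (atom-reply-stable p x G)
    ... | false = atom-reply-stable p x G

    reply-classical : ∀ x G → _/_ 𝕍 x G ≡ ⟦ x ⟧ (replies G)
    reply-classical TT       G = refl
    reply-classical (atom p) G = refl
    reply-classical (¬' x)   G = cong not (reply-classical x G)
    reply-classical (x ◁∧ y) G = begin
      _/_ 𝕍 (x ◁∧ y) G                               ≡⟨ ◁∧-reply x y G ⟩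
      _/_ 𝕍 x G ∧ _/_ 𝕍 y (_•_ 𝕍 x G)                ≡⟨ cong₂ _∧_ (reply-classical x G)
                                                                  (reply-classical y (_•_ 𝕍 x G)) ⟩
      ⟦ x ⟧ (replies G) ∧ ⟦ y ⟧ (replies (_•_ 𝕍 x G)) ≡⟨ cong (⟦ x ⟧ (replies G) ∧_)
                                                             (⟦⟧-cong y (λ p → atom-reply-stable p x G)) ⟩
      ⟦ x ⟧ (replies G) ∧ ⟦ y ⟧ (replies G)           ∎
      where open ≡-Reasoning

proposition3p10 : {a v : Level} {A : Set a} (𝕍 : ValuationAlgebra A v) → Static 𝕍 →
    (H : ValuationAlgebra.Carrier 𝕍) →
    Σ (A → Singleton H → Bool) (λ /₀ →
    Σ (A → Singleton H → Singleton H) (λ •₀ →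
    ∀ (x : Formula A) → _/_ 𝕍 x H ≡ _/_ (singletonAlgebra H /₀ •₀) x (H , refl)))
proposition3p10 {A = A} 𝕍 static H = /₀ , •₀ , λ x →
    trans (reply-classical 𝕍 (Static.st₅ static) x H)
          (sym (reply-classical (singletonAlgebra H /₀ •₀) (λ _ _ _ → refl) x (H , refl)))
  where
    open ValuationAlgebra 𝕍 using (_/ₐ_)

    /₀ : A → Singleton H → Bool
    /₀ p _ = p /ₐ H

    •₀ : A → Singleton H → Singleton H
    •₀ _ s = s
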